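{- Let $\mathcal{I}$ be an $(N_I^{\mathcal{A}},N_I^{\mathcal{T}})$-quasi-forest. Then every path in $\mathcal{I}$ whose first element is named is decomposable.
   Context: Individual names $N_I$, concept names, role names $N_R$ as usual; simple roles $s::=r\mid s^-\mid s\cap s\mid s\cup s\mid s\setminus s$. A path in $\mathcal{I}$ is a non-empty word $\rho=\rho_1\cdots\rho_n$ over $\Delta^{\mathcal{I}}$ such that for each $i<n$ there is a simple role $s$ with $(\rho_i,\rho_{i+1})\in s^{\mathcal{I}}$. Quasi-forest: with a fixed concept name $\mathsf{Root}$ and role names $\mathsf{child},\mathsf{edge},\mathsf{id}$, and finite $N_I^{\mathcal{A}},N_I^{\mathcal{T}}\subseteq N_I$, $\mathcal{I}$ is an $(N_I^{\mathcal{A}},N_I^{\mathcal{T}})$-quasi-forest if $\Delta^{\mathcal{I}}$ is a prefix-closed set of non-empty words over $\mathbb{N}$; $\mathsf{Root}^{\mathcal{I}}=\Delta^{\mathcal{I}}\cap\mathbb{N}=\{a^{\mathcal{I}}\mid a\in N_I\}=\{a^{\mathcal{I}}\mid a\in N_I^{\mathcal{A}}\cup N_I^{\mathcal{T}}\}$; $\mathsf{child}^{\mathcal{I}}=\{(d,d\cdot n)\mid d,d\cdot n\in\Delta^{\mathcal{I}}, n\in\mathbb{N}\}$; $\mathsf{edge}^{\mathcal{I}}=\bigcup_{r\in N_R}(r^{\mathcal{I}}\cup(r^-)^{\mathcal{I}})$; $\mathsf{id}^{\mathcal{I}}$ is the identity; and for each role name $r$ and $(d,e)\in r^{\mathcal{I}}$,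 either both $d,e\in\mathsf{Root}^{\mathcal{I}}$, or one of $d,e$ is $o^{\mathcal{I}}$ for some $o\in N_I^{\mathcal{T}}$, or $(d,e)\in\mathsf{id}^{\mathcal{I}}\cup\mathsf{child}^{\mathcal{I}}\cup(\mathsf{child}^-)^{\mathcal{I}}$. An element is named if it equals $a^{\mathcal{I}}$ for some $a\in N_I$. $d$ is a descendant of $c$ if $(c,d)\in(\mathsf{child}^{\mathcal{I}})^+$. A path is an $a$-subtree path if all its members are descendants of $a^{\mathcal{I}}$. Basic paths: for $a,b\in N_I^{\mathcal{A}}\cup N_I^{\mathcal{T}}$ and $o,o'\in N_I^{\mathcal{T}}$, a path $\rho$ is: $(a,b)$-direct if $\rho=a^{\mathcal{I}}b^{\mathcal{I}}$; $a$-inner if $\rho=a^{\mathcal{I}}\bar\rho$ for an $a$-subtree path $\bar\rho$; an $a$-roundtrip if $\rho=a^{\mathcal{I}}\bar\rho a^{\mathcal{I}}$ for an $a$-subtree path $\bar\rho$; $(a,o)$-inout if $\rho=\bar\rho o^{\mathcal{I}}$ for an $a$-inner path $\bar\rho$; $(a,o)$-outin if its reverse is $(a,o)$-inout; $(a,o)$-inner if $\rho=o^{\mathcal{I}}\bar\rho$ for an $a$-subtree path $\bar\rho$; an $(a,o,o')$-bypass if $\rho=o^{\mathcal{I}}\bar\rho o'^{\mathcal{I}}$ for an $a$-subtree path $\bar\rho$. A path is basic if it falls into one of these seven categories. A path $\rho$ is decomposable if there are indices $1=i_1<i_2<\cdots<i_k=|\rho|$ such that for every $j<k$ the infix $\rho_{i_j}\cdots\rho_{i_{j+1}}$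 is basic. -}

module Defs where

open import Data.Nat using (ℕ; _<_; _∸_; suc)
open import Data.List using (List; []; _∷_; _++_; [_]; length; take; drop; reverse)
open import Data.List.NonEmpty using (List⁺; _⁺++_; _⁺∷ʳ_; tail)
open import Data.List.Membership.Propositional using (_∈_)
open import Data.List.Relation.Unary.All using (All)
open import Data.Product using (Σ; ∃; _×_)
open import Data.Sum using (_⊎_)
open import Data.Unit using (⊤)
open import Relation.Nullary using (¬_)
open import Relation.Binary.PropositionalEquality using (_≡_; _≢_)
open import Relation.Binary.Construct.Closure.Transitive using (TransClosure)
open import Function.Bundles using (_⇔_)

Word : Set
Word = List⁺ ℕ

record Signature : Set₁ where
  field
    NI : Set
    NC : Set
    NR : Set
    Root : NC
    child edge idr : NR
    child≢edge : child ≢ edge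
    child≢id   : child ≢ idr
    edge≢id    : edge ≢ idr

record Interp (S : Signature) : Set₁ where
  open Signature S
  field
    Δ    : Word → Set
    ind  : NI → Word
    conc : NC → Word → Set
    role : NR → Word → Word → Set
    ind∈Δ  : ∀ a → Δ (ind a)
    conc⊆Δ : ∀ A d → conc A d → Δ d
    role⊆Δ : ∀ r d e → role r d e → Δ d × Δ e

module _ {S : Signature} (I : Interp S) where
  open Signature S
  open Interp I

  data SRole : Set where
    nm   : NR → SRole
    inv  : SRole → SRole
    _∩ʳ_ : SRole → SRole → SRole
    _∪ʳ_ : SRole → SRole → SRole
    _∖ʳ_ : SRole → SRole → SRole

  ⟦_⟧ : SRole → Word → Word → Set
  ⟦ nm r ⟧ d e = role r d e
  ⟦ inv s ⟧ d e = ⟦ s ⟧ e d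
  ⟦ s ∩ʳ t ⟧ d e = ⟦ s ⟧ d e × ⟦ t ⟧ d e
  ⟦ s ∪ʳ t ⟧ d e = ⟦ s ⟧ d e ⊎ ⟦ t ⟧ d e
  ⟦ s ∖ʳ t ⟧ d e = ⟦ s ⟧ d e × ¬ ⟦ t ⟧ d e

  Linked : List Word → Set
  Linked [] = ⊤
  Linked (x ∷ []) = ⊤
  Linked (x ∷ y ∷ ρ) = (Σ SRole λ s → ⟦ s ⟧ x y) × Linked (y ∷ ρ)

  IsPath : List Word → Set
  IsPath ρ = (ρ ≢ []) × All Δ ρ × Linked ρ

  record QuasiForest (NA NT : List NI) : Set where
    field
      prefixClosed : ∀ (w : Word) (v : List ℕ) → Δ (w ⁺++ v) → Δ w
      root-Δℕ   : ∀ w → conc Root w ⇔ (Δ w × tail w ≡ [])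
      root-NI   : ∀ w → conc Root w ⇔ (∃ λ a → ind a ≡ w)
      root-NAT  : ∀ w → conc Root w ⇔ (∃ λ a → a ∈ (NA ++ NT) × ind a ≡ w)
      child-def : ∀ d e → role child d e ⇔ (Δ d × Δ e × ∃ λ n → e ≡ d ⁺∷ʳ n)
      edge-def  : ∀ d e → role edge d e ⇔ (∃ λ r → role r d e ⊎ role r e d)
      id-def    : ∀ d e → role idr d e ⇔ (Δ d × d ≡ e)
      forest    : ∀ r d e → role r d e →
                    (conc Root d × conc Root e)
                    ⊎ (∃ λ o → o ∈ NT × (ind o ≡ d ⊎ ind o ≡ e))
                    ⊎ (role idr d e ⊎ role child d e ⊎ role child e d)

  Named : Word → Set
  Named d = ∃ λ a → ind a ≡ d

  Descendant : Word → Word → Set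
  Descendant c d = TransClosure (role child) c d

  SubtreePath : NI → List Word → Set
  SubtreePath a ρ = IsPath ρ × All (Descendant (ind a)) ρ

  module _ (NA NT : List NI) where
    InnerP : NI → List Word → Set
    InnerP a ρ = Σ (List Word) λ ρ' → SubtreePath a ρ' × ρ ≡ ind a ∷ ρ'

    InOut : NI → NI → List Word → Set
    InOut a o ρ = Σ (List Word) λ ρ' → InnerP a ρ' × ρ ≡ ρ' ++ [ ind o ]

    BasicShape : List Word → Set
    BasicShape ρ =
        (Σ NI λ a → Σ NI λ b → a ∈ (NA ++ NT) × b ∈ (NA ++ NT)
           × ρ ≡ ind a ∷ ind b ∷ [])
      ⊎ (Σ NI λ a → a ∈ (NA ++ NT) × InnerP a ρ)
      ⊎ (Σ NI λ a → a ∈ (NA ++ NT) × Σ (List Word) λ ρ' →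
           SubtreePath a ρ' × ρ ≡ ind a ∷ (ρ' ++ [ ind a ]))
      ⊎ (Σ NI λ a → Σ NI λ o → a ∈ (NA ++ NT) × o ∈ NT × InOut a o ρ)
      ⊎ (Σ NI λ a → Σ NI λ o → a ∈ (NA ++ NT) × o ∈ NT
           × InOut a o (reverse ρ))
      ⊎ (Σ NI λ a → Σ NI λ o → a ∈ (NA ++ NT) × o ∈ NT × Σ (List Word) λ ρ' →
           SubtreePath a ρ' × ρ ≡ ind o ∷ ρ')
      ⊎ (Σ NI λ a → Σ NI λ o → Σ NI λ o' → a ∈ (NA ++ NT) × o ∈ NT × o' ∈ NT
           × Σ (List Word) λ ρ' →
           SubtreePath a ρ' × ρ ≡ ind o ∷ (ρ' ++ [ ind o' ]))

    Basic : List Word → Set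
    Basic ρ = IsPath ρ × BasicShape ρ

    -- infix ρ_i … ρ_j (0-based, inclusive)
    infixL : List Word → ℕ → ℕ → List Word
    infixL ρ i j = take (suc j ∸ i) (drop i ρ)

    Segs : List Word → ℕ → List ℕ → Set
    Segs ρ i [] = i ≡ length ρ ∸ 1
    Segs ρ i (j ∷ js) = i < j × Basic (infixL ρ i j) × Segs ρ j js

    Decomposable : List Word → Set
    Decomposable ρ = Σ (List ℕ) λ js → Segs ρ 0 js

{-# OPTIONS --safe #-}
-- Every link of a quasi-forest either stays inside one tree, joins two roots, or touches a
-- nominal o ∈ N_I^T, which is itself a root. Hence a path that starts at a root alternates
-- between direct steps from root to root and excursions into the subtree of a single root a.
-- Such an excursion is entered from a^I or from a nominal and, unless the path ends inside
-- it, is left towards a^I or a nominal; in each of these cases it is a basic path.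
module Submission where

open import Defs
open import Data.Empty using (⊥-elim)
open import Data.List using (List; []; _∷_; _++_; [_]; length; map; reverse; _ʳ++_; take)
open import Data.List.NonEmpty using (head; tail; _⁺++_; _⁺∷ʳ_) renaming (_∷_ to _∷⁺_)
open import Data.List.Properties
  using (++-assoc; ++-conicalʳ; length-++; length-++-sucʳ; reverse-++; reverse-injective; unfold-reverse; ≡-dec)
open import Data.List.Membership.Propositional using (_∈_)
open import Data.List.Relation.Unary.All using (All; []; _∷_; lookup; tabulate)
open import Data.List.Relation.Unary.All.Properties using (++⁻ˡ)
import Data.List.Relation.Unary.Any.Properties as Any
open import Data.Nat using (suc; _+_; _∸_; s≤s; z≤n; _≟_)
open import Data.Nat.Properties using (+-identityʳ; +-monoʳ-<)
open import Data.Product using (Σ; _×_; _,_; proj₂)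
open import Data.Sum using (_⊎_; inj₁; inj₂; swap)
open import Data.Unit using (tt)
open import Function using (_∘_)
open import Function.Bundles using (module Equivalence)
open import Relation.Nullary using (¬_; Dec; yes; no)
open import Relation.Binary.PropositionalEquality
  using (_≡_; _≢_; refl; sym; trans; cong; subst; module ≡-Reasoning)
open import Relation.Binary.Construct.Closure.Transitive using (_∷_) renaming ([_] to [_]⁺)

open Equivalence using (to; from)

All-reverse : ∀ {A : Set} {P : A → Set} {xs} → All P xs → All P (reverse xs)
All-reverse ps = tabulate (lookup ps ∘ Any.reverse⁻)

take-length-++-∷ : ∀ {A : Set} (xs : List A) t τ → take (suc (length xs)) (xs ++ t ∷ τ) ≡ xs ++ [ t ]
take-length-++-∷ []       t τ = refl
take-length-++-∷ (x ∷ xs) t τ = cong (x ∷_) (take-length-++-∷ xs t τ)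

reverse-∷-∷ʳ : ∀ {A : Set} (x : A) π t → reverse (x ∷ π ++ [ t ]) ≡ t ∷ reverse π ++ [ x ]
reverse-∷-∷ʳ x π t = trans (unfold-reverse x (π ++ [ t ])) (cong (_++ [ x ]) (reverse-++ π [ t ]))

module _ {S : Signature} (I : Interp S) where
  open Interp I

  Link : Word → Word → Set
  Link d e = Σ (SRole I) λ s → ⟦_⟧ I s d e

  Link-sym : ∀ {d e} → Link d e → Link e d
  Link-sym (s , sde) = inv s , sde

  Linked-∷⁻ : ∀ {x} π → Linked I (x ∷ π) → Linked I π
  Linked-∷⁻ []      _       = tt
  Linked-∷⁻ (_ ∷ _) (_ , l) = l

  Linked-++⁻ˡ : ∀ xs {ys} → Linked I (xs ++ ys) → Linked I xs
  Linked-++⁻ˡ []           _        = tt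
  Linked-++⁻ˡ (_ ∷ [])     _        = tt
  Linked-++⁻ˡ (_ ∷ y ∷ xs) (l , ls) = l , Linked-++⁻ˡ (y ∷ xs) ls

  Linked-ʳ++ : ∀ {x} xs {acc} → Linked I (x ∷ xs) → Linked I (x ∷ acc) → Linked I (xs ʳ++ x ∷ acc)
  Linked-ʳ++ []       _                lacc = lacc
  Linked-ʳ++ (_ ∷ xs) ((s , sxy) , l) lacc = Linked-ʳ++ xs l ((inv s , sxy) , lacc)

  Linked-reverse : ∀ π → Linked I π → Linked I (reverse π)
  Linked-reverse []      _ = tt
  Linked-reverse (_ ∷ π) l = Linked-ʳ++ π l tt

  IsPath-∷⁻ : ∀ {x π} → π ≢ [] → IsPath I (x ∷ π) → IsPath I π
  IsPath-∷⁻ {π = π} π≢[] (_ , _ ∷ Δπ , l) = π≢[] , Δπ , Linked-∷⁻ π l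

  IsPath-++⁻ˡ : ∀ x xs {ys} → IsPath I (x ∷ xs ++ ys) → IsPath I (x ∷ xs)
  IsPath-++⁻ˡ x xs (_ , Δs , l) = (λ ()) , ++⁻ˡ (x ∷ xs) Δs , Linked-++⁻ˡ (x ∷ xs) l

  IsPath-reverse : ∀ {π} → IsPath I π → IsPath I (reverse π)
  IsPath-reverse {π} (π≢[] , Δπ , l) =
    (λ eq → π≢[] (reverse-injective {x = π} {y = []} eq)) , All-reverse Δπ , Linked-reverse π l

  SubtreePath-reverse : ∀ {a π} → SubtreePath I a π → SubtreePath I a (reverse π)
  SubtreePath-reverse (p , ds) = IsPath-reverse p , All-reverse ds

  module _ (NA NT : List (Signature.NI S)) where

    infixr 5 _◅_

    data Decomposition : List Word → Set where
      [-] : ∀ {x} → Decomposition [ x ]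
      _◅_ : ∀ {x seg t τ} → Basic I NA NT (x ∷ seg ++ [ t ]) → Decomposition (t ∷ τ) →
            Decomposition (x ∷ seg ++ t ∷ τ)

    infixL-++ : ∀ xs ρ i j →
                infixL I NA NT (xs ++ ρ) (length xs + i) (length xs + j) ≡ infixL I NA NT ρ i j
    infixL-++ []       ρ i j = refl
    infixL-++ (_ ∷ xs) ρ i j = infixL-++ xs ρ i j

    Segs-++ : ∀ xs t τ {i} js → Segs I NA NT (t ∷ τ) i js →
              Segs I NA NT (xs ++ t ∷ τ) (length xs + i) (map (length xs +_) js)
    Segs-++ xs t τ {i} [] i≡ = begin
      length xs + i                ≡⟨ cong (length xs +_) i≡ ⟩
      length xs + length τ         ≡⟨ length-++ xs ⟨
      length (xs ++ τ)             ≡⟨ cong (_∸ 1) (length-++-sucʳ xs t τ) ⟨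
      length (xs ++ t ∷ τ) ∸ 1     ∎
      where open ≡-Reasoning
    Segs-++ xs t τ (j ∷ js) (i<j , b , segs) =
      +-monoʳ-< (length xs) i<j ,
      subst (Basic I NA NT) (sym (infixL-++ xs (t ∷ τ) _ j)) b ,
      Segs-++ xs t τ js segs

    Decomposition⇒Decomposable : ∀ {ρ} → Decomposition ρ → Decomposable I NA NT ρ
    Decomposition⇒Decomposable [-] = [] , refl
    Decomposition⇒Decomposable (_◅_ {x} {seg} {t} {τ} b d) with Decomposition⇒Decomposable d
    ... | js , segs =
      suc (length seg) ∷ map (suc (length seg) +_) js ,
      s≤s z≤n ,
      subst (Basic I NA NT) (sym (cong (x ∷_) (take-length-++-∷ seg t τ))) b ,
      subst (λ i → Segs I NA NT (x ∷ seg ++ t ∷ τ) i (map (suc (length seg) +_) js))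
            (+-identityʳ _) (Segs-++ (x ∷ seg) t τ js segs)

    module _ (Q : QuasiForest I NA NT) where
      open Signature S
      open QuasiForest Q

      IsRoot : Word → Set
      IsRoot w = tail w ≡ []

      isRoot? : ∀ w → Dec (IsRoot w)
      isRoot? w = ≡-dec _≟_ (tail w) []

      Nominal : Word → Set
      Nominal w = Σ NI λ o → o ∈ NT × ind o ≡ w

      Endpoint : NI → Word → Set
      Endpoint a w = ind a ≡ w ⊎ Nominal w

      Root⇒isRoot : ∀ {w} → conc Root w → IsRoot w
      Root⇒isRoot {w} Rw = proj₂ (to (root-Δℕ w) Rw)

      named⇒isRoot : ∀ {w} → Named I w → IsRoot w
      named⇒isRoot {w} named = Root⇒isRoot (from (root-NI w) named)

      ind-isRoot : ∀ a → IsRoot (ind a)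
      ind-isRoot a = named⇒isRoot (a , refl)

      root⇒named : ∀ {w} → Δ w → IsRoot w → Σ NI λ a → a ∈ NA ++ NT × ind a ≡ w
      root⇒named {w} Δw root = to (root-NAT w) (from (root-Δℕ w) (Δw , root))

      rootOf : ∀ {w} → Δ w → Σ NI λ a → a ∈ NA ++ NT × head w ≡ head (ind a)
      rootOf {w} Δw with root⇒named (prefixClosed (head w ∷⁺ []) (tail w) Δw) refl
      ... | a , a∈ , ind-a≡ = a , a∈ , cong head (sym ind-a≡)

      root-≡ : ∀ {v w} → IsRoot v → IsRoot w → head v ≡ head w → v ≡ w
      root-≡ {_ ∷⁺ _} {_ ∷⁺ _} refl refl refl = refl

      ForestStep : Word → Word → Set
      ForestStep d e = (IsRoot d × IsRoot e) ⊎ (Nominal d ⊎ Nominal e) ⊎ head d ≡ head e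

      ForestStep-sym : ∀ {d e} → ForestStep d e → ForestStep e d
      ForestStep-sym (inj₁ (rd , re))  = inj₁ (re , rd)
      ForestStep-sym (inj₂ (inj₁ nom)) = inj₂ (inj₁ (swap nom))
      ForestStep-sym (inj₂ (inj₂ h))   = inj₂ (inj₂ (sym h))

      child-head : ∀ {d e} → role child d e → head d ≡ head e
      child-head {d} {e} cde with to (child-def d e) cde
      ... | _ , _ , _ , refl = refl

      role-forestStep : ∀ {r d e} → role r d e → ForestStep d e
      role-forestStep {r} {d} {e} rde with forest r d e rde
      ... | inj₁ (Rd , Re) = inj₁ (Root⇒isRoot Rd , Root⇒isRoot Re)
      ... | inj₂ (inj₁ (o , o∈ , inj₁ eq)) = inj₂ (inj₁ (inj₁ (o , o∈ , eq)))
      ... | inj₂ (inj₁ (o , o∈ , inj₂ eq)) = inj₂ (inj₁ (inj₂ (o , o∈ , eq)))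
      ... | inj₂ (inj₂ (inj₁ ide))         = inj₂ (inj₂ (cong head (proj₂ (to (id-def d e) ide))))
      ... | inj₂ (inj₂ (inj₂ (inj₁ cde)))  = inj₂ (inj₂ (child-head cde))
      ... | inj₂ (inj₂ (inj₂ (inj₂ ced)))  = inj₂ (inj₂ (sym (child-head ced)))

      sRole-forestStep : ∀ s {d e} → ⟦_⟧ I s d e → ForestStep d e
      sRole-forestStep (nm r)   rde        = role-forestStep rde
      sRole-forestStep (inv s) {d} {e} sed = ForestStep-sym (sRole-forestStep s {e} {d} sed)
      sRole-forestStep (s ∩ʳ _) (sde , _)  = sRole-forestStep s sde
      sRole-forestStep (s ∪ʳ _) (inj₁ sde) = sRole-forestStep s sde
      sRole-forestStep (_ ∪ʳ t) (inj₂ tde) = sRole-forestStep t tde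
      sRole-forestStep (s ∖ʳ _) (sde , _)  = sRole-forestStep s sde

      nonRoot-link : ∀ {d e} → ¬ IsRoot d → Link d e → Nominal e ⊎ head d ≡ head e
      nonRoot-link ¬rd (s , sde) with sRole-forestStep s sde
      ... | inj₁ (rd , _)                  = ⊥-elim (¬rd rd)
      ... | inj₂ (inj₁ (inj₁ (o , _ , eq))) = ⊥-elim (¬rd (subst IsRoot eq (ind-isRoot o)))
      ... | inj₂ (inj₁ (inj₂ nom))         = inj₁ nom
      ... | inj₂ (inj₂ h)                  = inj₂ h

      stays-in-tree : ∀ {d e} → ¬ IsRoot d → ¬ IsRoot e → Link d e → head d ≡ head e
      stays-in-tree ¬rd ¬re l with nonRoot-link ¬rd l
      ... | inj₁ (o , _ , eq) = ⊥-elim (¬re (subst IsRoot eq (ind-isRoot o)))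
      ... | inj₂ h            = h

      leaves-tree-at-endpoint : ∀ a {d e} → ¬ IsRoot d → IsRoot e → head d ≡ head (ind a) → Link d e →
                                Endpoint a e
      leaves-tree-at-endpoint a ¬rd re hd l with nonRoot-link ¬rd l
      ... | inj₁ nom = inj₂ nom
      ... | inj₂ h   = inj₁ (root-≡ (ind-isRoot a) re (trans (sym hd) h))

      child-snoc : ∀ w x → Δ (w ⁺∷ʳ x) → role child w (w ⁺∷ʳ x)
      child-snoc w x Δwx = from (child-def w (w ⁺∷ʳ x)) (prefixClosed w [ x ] Δwx , Δwx , x , refl)

      descendant-extension : ∀ w x u → Δ (w ⁺++ (x ∷ u)) → Descendant I w (w ⁺++ (x ∷ u))
      descendant-extension w x []      Δw+ = [ child-snoc w x Δw+ ]⁺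
      descendant-extension w x (y ∷ u) Δw+ =
        child-snoc w x (prefixClosed (w ⁺∷ʳ x) (y ∷ u) Δwx+)
          ∷ subst (Descendant I (w ⁺∷ʳ x)) eq (descendant-extension (w ⁺∷ʳ x) y u Δwx+)
        where
        eq : (w ⁺∷ʳ x) ⁺++ (y ∷ u) ≡ w ⁺++ (x ∷ y ∷ u)
        eq = cong (head w ∷⁺_) (++-assoc (tail w) [ x ] (y ∷ u))
        Δwx+ : Δ ((w ⁺∷ʳ x) ⁺++ (y ∷ u))
        Δwx+ = subst Δ (sym eq) Δw+

      descendant-of-root : ∀ {c w} → IsRoot c → Δ w → ¬ IsRoot w → head w ≡ head c →
                           Descendant I c w
      descendant-of-root {_ ∷⁺ _} {_ ∷⁺ []}      _    _  ¬rw _    = ⊥-elim (¬rw refl)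
      descendant-of-root {h ∷⁺ _} {_ ∷⁺ (x ∷ u)} refl Δw _   refl = descendant-extension (h ∷⁺ []) x u Δw

      pattern direct p       = inj₁ p
      pattern inner p        = inj₂ (inj₁ p)
      pattern roundtrip p    = inj₂ (inj₂ (inj₁ p))
      pattern inout p        = inj₂ (inj₂ (inj₂ (inj₁ p)))
      pattern outin p        = inj₂ (inj₂ (inj₂ (inj₂ (inj₁ p))))
      pattern nominalInner p = inj₂ (inj₂ (inj₂ (inj₂ (inj₂ (inj₁ p)))))
      pattern bypass p       = inj₂ (inj₂ (inj₂ (inj₂ (inj₂ (inj₂ p)))))

      direct-shape : ∀ {x y} → Δ x → IsRoot x → Δ y → IsRoot y → BasicShape I NA NT (x ∷ y ∷ [])
      direct-shape Δx rx Δy ry with root⇒named Δx rx | root⇒named Δy ry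
      ... | a , a∈ , refl | b , b∈ , refl = direct (a , b , a∈ , b∈ , refl)

      entering-shape : ∀ {a x π} → a ∈ NA ++ NT → SubtreePath I a π → Endpoint a x →
                       BasicShape I NA NT (x ∷ π)
      entering-shape a∈ sp (inj₁ refl)             = inner (_ , a∈ , _ , sp , refl)
      entering-shape a∈ sp (inj₂ (o , o∈ , refl)) = nominalInner (_ , o , a∈ , o∈ , _ , sp , refl)

      crossing-shape : ∀ {a x π t} → a ∈ NA ++ NT → SubtreePath I a π → Endpoint a x → Endpoint a t →
                       BasicShape I NA NT (x ∷ π ++ [ t ])
      crossing-shape a∈ sp (inj₁ refl) (inj₁ refl) = roundtrip (_ , a∈ , _ , sp , refl)
      crossing-shape a∈ sp (inj₁ refl) (inj₂ (o , o∈ , refl)) =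
        inout (_ , o , a∈ , o∈ , _ , (_ , sp , refl) , refl)
      crossing-shape {π = π} a∈ sp (inj₂ (o , o∈ , refl)) (inj₁ refl) =
        outin (_ , o , a∈ , o∈ , _ , (reverse π , SubtreePath-reverse sp , refl) , reverse-∷-∷ʳ _ π _)
      crossing-shape a∈ sp (inj₂ (o , o∈ , refl)) (inj₂ (o' , o'∈ , refl)) =
        bypass (_ , o , o' , a∈ , o∈ , o'∈ , _ , sp , refl)

      data SubtreeRun (a : NI) : List Word → Set where
        inside : ∀ {ρ t} → All (Descendant I (ind a)) (ρ ++ [ t ]) → SubtreeRun a (ρ ++ [ t ])
        leaves : ∀ {z ρ t τ} → All (Descendant I (ind a)) (z ∷ ρ) → Endpoint a t → Decomposition (t ∷ τ) →
                 SubtreeRun a (z ∷ ρ ++ t ∷ τ)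

      _∷ᴿ_ : ∀ {a z π} → Descendant I (ind a) z → SubtreeRun a π → SubtreeRun a (z ∷ π)
      _∷ᴿ_ {z = z} dz (inside {ρ} ds)           = inside {ρ = z ∷ ρ} (dz ∷ ds)
      _∷ᴿ_ {z = z} dz (leaves {ρ = ρ} ds end d) = leaves {ρ = _ ∷ ρ} (dz ∷ ds) end d

      enterSubtree : ∀ {a x π} → a ∈ NA ++ NT → Endpoint a x → IsPath I (x ∷ π) → SubtreeRun a π →
                     Decomposition (x ∷ π)
      enterSubtree a∈ start p (inside {ρ} {t} ds) =
        (p , entering-shape a∈ (IsPath-∷⁻ ρ++[t]≢[] p , ds) start) ◅ [-]
        where
        ρ++[t]≢[] : ρ ++ [ t ] ≢ []
        ρ++[t]≢[] eq with ++-conicalʳ ρ [ t ] eq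
        ... | ()
      enterSubtree {x = x} a∈ start p (leaves {z} {ρ} {t} {τ} ds end d) =
        _◅_ {seg = z ∷ ρ} (segment , crossing-shape a∈ (run , ds) start end) d
        where
        segment : IsPath I (x ∷ z ∷ ρ ++ [ t ])
        segment = IsPath-++⁻ˡ x (z ∷ ρ ++ [ t ])
                    (subst (IsPath I) (cong (λ π → x ∷ z ∷ π) (sym (++-assoc ρ [ t ] τ))) p)
        run : IsPath I (z ∷ ρ)
        run = IsPath-++⁻ˡ z ρ (IsPath-∷⁻ (λ ()) p)

      mutual
        decomposeFromRoot : ∀ x ρ → IsRoot x → IsPath I (x ∷ ρ) → Decomposition (x ∷ ρ)
        decomposeFromRoot x []      _  _ = [-]
        decomposeFromRoot x (y ∷ ρ) rx p@(_ , Δx ∷ Δy ∷ _ , lxy , _) with isRoot? y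
        ... | yes ry =
          _◅_ {seg = []} (IsPath-++⁻ˡ x [ y ] p , direct-shape Δx rx Δy ry)
                         (decomposeFromRoot y ρ ry (IsPath-∷⁻ (λ ()) p))
        ... | no ¬ry with rootOf Δy
        ...   | a , a∈ , hy =
          enterSubtree a∈ (leaves-tree-at-endpoint a ¬ry rx hy (Link-sym lxy)) p
                       (subtreeRun a y ρ ¬ry hy (IsPath-∷⁻ (λ ()) p))

        subtreeRun : ∀ a z σ → ¬ IsRoot z → head z ≡ head (ind a) → IsPath I (z ∷ σ) →
                     SubtreeRun a (z ∷ σ)
        subtreeRun a z [] ¬rz hz (_ , Δz ∷ _ , _) =
          inside {ρ = []} (descendant-of-root (ind-isRoot a) Δz ¬rz hz ∷ [])
        subtreeRun a z (w ∷ σ) ¬rz hz p@(_ , Δz ∷ _ , lzw , _)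
          with isRoot? w | descendant-of-root (ind-isRoot a) Δz ¬rz hz
        ... | yes rw | dz =
          leaves {ρ = []} (dz ∷ []) (leaves-tree-at-endpoint a ¬rz rw hz lzw)
                 (decomposeFromRoot w σ rw (IsPath-∷⁻ (λ ()) p))
        ... | no ¬rw | dz =
          dz ∷ᴿ subtreeRun a w σ ¬rw (trans (sym (stays-in-tree ¬rz ¬rw lzw)) hz) (IsPath-∷⁻ (λ ()) p)

lemma3 : (S : Signature) (I : Interp S) (NA NT : List (Signature.NI S)) →
         QuasiForest I NA NT →
         (x : Word) (ρ : List Word) → IsPath I (x ∷ ρ) → Named I x →
         Decomposable I NA NT (x ∷ ρ)
lemma3 S I NA NT Q x ρ p named =
  Decomposition⇒Decomposable I NA NT (decomposeFromRoot I NA NT Q x ρ (named⇒isRoot I NA NT Q named) p)
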